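{- Let $m,i,k$ be positive integers and let $$\mathbb{M}_{k}^{(m,i)}=\sum_{j=0}^{\infty}\frac{(-1)^{j}}{(mj+i)^{k}}.$$ Then $$\mathbb{M}_{k}^{(m,i)}=\sum_{n=0}^{\infty}\frac{n!}{2^{n+1}\,m\,(i/m)_{n+1}}\,B_{n,k-1}^{(m,i)},$$ where the numbers $B_{n,k}^{(m,i)}$ are defined by $B_{n,0}^{(m,i)}=1$ for all $n\ge0$ and $B_{n,k}^{(m,i)}=\sum_{j=0}^{n}\frac{1}{mj+i}B_{j,k-1}^{(m,i)}$ for $n\ge0$, $k\ge1$.
   Context: $(a)_n=a(a+1)\cdots(a+n-1)$ denotes the rising factorial. -}

module Defs where

open import Data.Nat as ℕ using (ℕ; zero; suc)
open import Data.Integer using (+_)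
open import Data.Rational using (ℚ; 0ℚ; 1ℚ; _+_; _*_; -_; _/_; 1/_; ≢-nonZero)
open import Data.Rational.Properties using (_≟_)
open import Relation.Nullary using (yes; no)

ι : ℕ → ℚ
ι n = + n / 1

-- reciprocal of a natural number (junk value 0 at 0; only used at positive arguments)
inv : ℕ → ℚ
inv zero    = 0ℚ
inv (suc n) = + 1 / suc n

-- total reciprocal on ℚ (junk value 0 at 0; only used at nonzero arguments)
rec : ℚ → ℚ
rec q with q ≟ 0ℚ
... | yes _  = 0ℚ
... | no q≢0 = 1/_ q {{≢-nonZero q≢0}}

sgn : ℕ → ℚ
sgn zero    = 1ℚ
sgn (suc j) = - sgn j

pow : ℚ → ℕ → ℚ
pow q zero    = 1ℚ
pow q (suc k) = q * pow q k

sumTo : ℕ → (ℕ → ℚ) → ℚ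
sumTo zero    f = 0ℚ
sumTo (suc N) f = sumTo N f + f N

prodTo : ℕ → (ℕ → ℚ) → ℚ
prodTo zero    f = 1ℚ
prodTo (suc N) f = prodTo N f * f N

rising : ℚ → ℕ → ℚ
rising a n = prodTo n (λ t → a + ι t)

B : (m i : ℕ) → ℕ → ℕ → ℚ
B m i n zero    = 1ℚ
B m i n (suc k) = sumTo (suc n) (λ j → inv (m ℕ.* j ℕ.+ i) * B m i j k)

lhsTerm : (m i k : ℕ) → ℕ → ℚ
lhsTerm m i k j = sgn j * pow (inv (m ℕ.* j ℕ.+ i)) k

rhsTerm : (m i k : ℕ) → ℕ → ℚ
rhsTerm m i k n =
  ι (n ℕ.!) * rec (ι (2 ℕ.^ suc n) * ι m * rising (ι i * inv m) (suc n)) * B m i n (k ℕ.∸ 1)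

module Submission where

-- The right-hand series is Euler's transform of M_k^{(m,i)} = Σ_j (-1)^j / (m j + i)^k.
--
-- For a sequence f let diff n f = ((1 - E)ⁿ f)(0), E the shift. Euler's transformation turns
-- the alternating series Σ_j (-1)^j f j into Σ_n diff n f / 2^{n+1}. The proof has two parts.
--
-- For f_k j = 1/(m j + i)^k a Leibniz rule for diff against the affine weight m j + i
-- yields the closed form diff n f_{k+1} = prefactor n · B_{n,k}, prefactor n = m^n n!/∏_{j≤n}(m j + i);
-- comparing prefactor n with 2^{n+1} m (i/m)_{n+1} shows that the n-th term of the right-hand
-- series is exactly diff n f_k / 2^{n+1} (rhsTerm≡euler).
--
-- Analysis, for any completely monotone f (every iterated difference of every shift is ≥ 0) with
-- f n ≤ 1/(n+1). The error D_N f = S_N f - T_N f between the partial sums of the two series obeys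
-- D_{N+1} f = ½ (D_N (Δ f) + (-1)^N f N); hence ∣D_N f∣ ≤ M_N f for a linear, monotone majorant M,
-- and splitting f j ≤ 2^L 2^{-j} + 1/(L+1) gives M_N f ≤ 2^L (3/4)^N + 1/(L+1), so D_N f → 0.
-- Leibniz's estimate makes S_N f Cauchy, hence T_N f too (module EulerTransform).
--
-- The closed form also shows that f_{k+1} is completely monotone, and theorem1 combines both parts.

open import Defs
open import Data.Nat as ℕ using (ℕ)
open import Data.Product using (Σ; _×_)
open import Data.Rational using (ℚ; 0ℚ; _<_; _-_; ∣_∣)

open import Data.Nat using (zero; suc)
import Data.Nat.Properties as ℕP
import Data.Nat.Coprimality as Coprime
open import Data.Integer as ℤ using (+_; -[1+_])
import Data.Integer.Properties as ℤP
open import Data.Rational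
open import Data.Rational.Properties
open import Data.Product using (_,_; proj₁; proj₂)
open import Data.Sum using (inj₁; inj₂)
open import Data.Empty using (⊥-elim)
open import Relation.Nullary using (yes; no)
open import Relation.Nullary.Decidable.Core using (dec⇒maybe)
open import Relation.Binary.PropositionalEquality
open import Tactic.RingSolver using (solve-∀)
open import Tactic.RingSolver.Core.AlmostCommutativeRing using (AlmostCommutativeRing; fromCommutativeRing)

ℚ-ring : AlmostCommutativeRing _ _
ℚ-ring = fromCommutativeRing +-*-commutativeRing (λ x → dec⇒maybe (0ℚ ≟ x))

≤⇒0≤- : ∀ {x y} → x ≤ y → 0ℚ ≤ y - x
≤⇒0≤- {x} {y} x≤y = subst (_≤ y - x) (+-inverseʳ x) (+-monoˡ-≤ (- x) x≤y)

0≤-⇒≤ : ∀ {x y} → 0ℚ ≤ y - x → x ≤ y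
0≤-⇒≤ {x} {y} h = subst₂ _≤_ (+-identityˡ x) (cancel y x) (+-monoˡ-≤ x h)
  where
  cancel : ∀ y x → y - x + x ≡ y
  cancel = solve-∀ ℚ-ring

0≤+ : ∀ {a b} → 0ℚ ≤ a → 0ℚ ≤ b → 0ℚ ≤ a + b
0≤+ = +-mono-≤

0≤* : ∀ {a b} → 0ℚ ≤ a → 0ℚ ≤ b → 0ℚ ≤ a * b
0≤* {a} {b} p q = nonNegative⁻¹ (a * b) {{nonNeg*nonNeg⇒nonNeg a {{nonNegative p}} b {{nonNegative q}}}}

0<* : ∀ {a b} → 0ℚ < a → 0ℚ < b → 0ℚ < a * b
0<* {a} {b} p q = positive⁻¹ (a * b) {{pos*pos⇒pos a {{positive p}} b {{positive q}}}}

scale-≤ : ∀ {a x y} → 0ℚ ≤ a → x ≤ y → a * x ≤ a * y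
scale-≤ {a} 0≤a x≤y = *-monoˡ-≤-nonNeg a {{nonNegative 0≤a}} x≤y

x-y≤x : ∀ {x y} → 0ℚ ≤ y → x - y ≤ x
x-y≤x {x} {y} 0≤y = 0≤-⇒≤ (subst (0ℚ ≤_) (sym (cancel x y)) 0≤y)
  where
  cancel : ∀ x y → x - (x - y) ≡ y
  cancel = solve-∀ ℚ-ring

≤-+-nonneg : ∀ {x y z} → x ≤ y → 0ℚ ≤ z → x ≤ y + z
≤-+-nonneg {x} h 0≤z = subst (_≤ _) (+-identityʳ x) (+-mono-≤ h 0≤z)

halves : ∀ x → x * ½ + x * ½ ≡ x
halves x = trans (sym (*-distribˡ-+ x ½ ½)) (*-identityʳ x)

half-pos : ∀ {x} → 0ℚ < x → 0ℚ < x * ½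
half-pos 0<x = 0<* 0<x (positive⁻¹ ½)

ι-normal : ℕ → ℚ
ι-normal n = mkℚ (+ n) 0 (Coprime.sym (Coprime.1-coprimeTo n))

ι≡mkℚ : ∀ n → ι n ≡ ι-normal n
ι≡mkℚ n = normalize-coprime (Coprime.sym (Coprime.1-coprimeTo n))

ι-+ : ∀ a b → ι (a ℕ.+ b) ≡ ι a + ι b
ι-+ a b = trans (/-cong {+ (a ℕ.+ b)} {1} {+ a ℤ.* + 1 ℤ.+ + b ℤ.* + 1} {1 ℕ.* 1}
    (trans (ℤP.pos-+ a b) (sym (cong₂ ℤ._+_ (ℤP.*-identityʳ (+ a)) (ℤP.*-identityʳ (+ b))))) refl)
  (sym (cong₂ _+_ (ι≡mkℚ a) (ι≡mkℚ b)))

ι-* : ∀ a b → ι (a ℕ.* b) ≡ ι a * ι b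
ι-* a b = trans (/-cong {+ (a ℕ.* b)} {1} {+ a ℤ.* + b} {1 ℕ.* 1} (ℤP.pos-* a b) refl)
  (sym (cong₂ _*_ (ι≡mkℚ a) (ι≡mkℚ b)))

ι-suc : ∀ n → ι (suc n) ≡ 1ℚ + ι n
ι-suc n = ι-+ 1 n

ι-affine : ∀ m j i → ι (m ℕ.* j ℕ.+ i) ≡ ι m * ι j + ι i
ι-affine m j i = trans (ι-+ (m ℕ.* j) i) (cong (_+ ι i) (ι-* m j))

0≤ι : ∀ n → 0ℚ ≤ ι n
0≤ι n rewrite ι≡mkℚ n = nonNegative⁻¹ _

0<ι : ∀ n → 0ℚ < ι (suc n)
0<ι n rewrite ι≡mkℚ (suc n) = positive⁻¹ _

ι-mono : ∀ {a b} → a ℕ.≤ b → ι a ≤ ι b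
ι-mono {a} {b} a≤b = 0≤-⇒≤ (subst (0ℚ ≤_) difference (0≤ι (b ℕ.∸ a)))
  where
  cancel : ∀ x y → x + y - y ≡ x
  cancel = solve-∀ ℚ-ring
  difference : ι (b ℕ.∸ a) ≡ ι b - ι a
  difference = begin
    ι (b ℕ.∸ a)               ≡⟨ sym (cancel (ι (b ℕ.∸ a)) (ι a)) ⟩
    ι (b ℕ.∸ a) + ι a - ι a   ≡⟨ cong (_- ι a) (sym (ι-+ (b ℕ.∸ a) a)) ⟩
    ι (b ℕ.∸ a ℕ.+ a) - ι a   ≡⟨ cong (λ z → ι z - ι a) (ℕP.m∸n+n≡m a≤b) ⟩
    ι b - ι a                 ∎
    where open ≡-Reasoning

inv≡1/ι : ∀ n → inv (suc n) ≡ 1/ ι-normal (suc n)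
inv≡1/ι n = normalize-coprime (Coprime.1-coprimeTo (suc n))

ι*inv : ∀ n → 1 ℕ.≤ n → ι n * inv n ≡ 1ℚ
ι*inv (suc n) _ rewrite inv≡1/ι n | ι≡mkℚ (suc n) = *-inverseʳ (ι-normal (suc n))

inv*ι : ∀ n → 1 ℕ.≤ n → inv n * ι n ≡ 1ℚ
inv*ι n 1≤n = trans (*-comm (inv n) (ι n)) (ι*inv n 1≤n)

0≤inv : ∀ n → 0ℚ ≤ inv n
0≤inv zero    = ≤-refl
0≤inv (suc n) rewrite inv≡1/ι n = nonNegative⁻¹ _

0<inv : ∀ n → 0ℚ < inv (suc n)
0<inv n rewrite inv≡1/ι n = positive⁻¹ _

inv-antitone : ∀ {a b} → 1 ℕ.≤ a → a ℕ.≤ b → inv b ≤ inv a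
inv-antitone {a} {b} 1≤a a≤b = begin
  inv b                  ≡⟨ sym (*-identityʳ (inv b)) ⟩
  inv b * 1ℚ             ≡⟨ cong (inv b *_) (sym (ι*inv a 1≤a)) ⟩
  inv b * (ι a * inv a)  ≤⟨ scale-≤ (0≤inv b) (*-monoʳ-≤-nonNeg (inv a) {{nonNegative (0≤inv a)}} (ι-mono a≤b)) ⟩
  inv b * (ι b * inv a)  ≡⟨ sym (*-assoc (inv b) (ι b) (inv a)) ⟩
  inv b * ι b * inv a    ≡⟨ cong (_* inv a) (inv*ι b (ℕP.≤-trans 1≤a a≤b)) ⟩
  1ℚ * inv a             ≡⟨ *-identityˡ (inv a) ⟩
  inv a                  ∎
  where open ≤-Reasoning

inv≤1 : ∀ n → 1 ℕ.≤ n → inv n ≤ 1ℚ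
inv≤1 n 1≤n = inv-antitone ℕP.≤-refl 1≤n

*-rec : ∀ q → 0ℚ < q → q * rec q ≡ 1ℚ
*-rec q 0<q with q ≟ 0ℚ
... | yes q≡0 = ⊥-elim (<-irrefl (sym q≡0) 0<q)
... | no q≢0  = *-inverseʳ q {{≢-nonZero q≢0}}

pow-nonneg : ∀ {q} → 0ℚ ≤ q → ∀ n → 0ℚ ≤ pow q n
pow-nonneg 0≤q zero    = nonNegative⁻¹ 1ℚ
pow-nonneg 0≤q (suc n) = 0≤* 0≤q (pow-nonneg 0≤q n)

pow≤1 : ∀ {q} → 0ℚ ≤ q → q ≤ 1ℚ → ∀ n → pow q n ≤ 1ℚ
pow≤1 0≤q q≤1 zero    = ≤-refl
pow≤1 {q} 0≤q q≤1 (suc n) =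
  ≤-trans (subst (q * pow q n ≤_) (*-identityʳ q) (scale-≤ 0≤q (pow≤1 0≤q q≤1 n))) q≤1

pow-suc≤ : ∀ {q} → 0ℚ ≤ q → q ≤ 1ℚ → ∀ k → pow q (suc k) ≤ q
pow-suc≤ {q} 0≤q q≤1 k = subst (q * pow q k ≤_) (*-identityʳ q) (scale-≤ 0≤q (pow≤1 0≤q q≤1 k))

pow-antitone : ∀ {q} → 0ℚ ≤ q → q ≤ 1ℚ → ∀ {a b} → a ℕ.≤ b → pow q b ≤ pow q a
pow-antitone {q} 0≤q q≤1 {a} {b} a≤b =
  subst (λ z → pow q z ≤ pow q a) (ℕP.m∸n+n≡m a≤b) (go (b ℕ.∸ a))
  where
  go : ∀ d → pow q (d ℕ.+ a) ≤ pow q a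
  go zero    = ≤-refl
  go (suc d) = ≤-trans (subst (q * pow q (d ℕ.+ a) ≤_) (*-identityˡ _)
                 (*-monoʳ-≤-nonNeg (pow q (d ℕ.+ a)) {{nonNegative (pow-nonneg 0≤q (d ℕ.+ a))}} q≤1)) (go d)

pow-* : ∀ p q n → pow p n * pow q n ≡ pow (p * q) n
pow-* p q zero    = refl
pow-* p q (suc n) = trans (interchange p (pow p n) q (pow q n)) (cong ((p * q) *_) (pow-* p q n))
  where
  interchange : ∀ a b c d → (a * b) * (c * d) ≡ (a * c) * (b * d)
  interchange = solve-∀ ℚ-ring

pow-+ : ∀ q a b → pow q (a ℕ.+ b) ≡ pow q a * pow q b
pow-+ q zero    b = sym (*-identityˡ (pow q b))
pow-+ q (suc a) b = trans (cong (q *_) (pow-+ q a b)) (sym (*-assoc q (pow q a) (pow q b)))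

pow-1 : ∀ n → pow 1ℚ n ≡ 1ℚ
pow-1 zero    = refl
pow-1 (suc n) = trans (*-identityˡ (pow 1ℚ n)) (pow-1 n)

1≤pow-2 : ∀ n → 1ℚ ≤ pow (ι 2) n
1≤pow-2 zero    = ≤-refl
1≤pow-2 (suc n) = ≤-trans (1≤pow-2 n)
  (0≤-⇒≤ (subst (0ℚ ≤_) (sym (double (pow (ι 2) n))) (≤-trans (nonNegative⁻¹ 1ℚ) (1≤pow-2 n))))
  where
  double : ∀ x → (1ℚ + 1ℚ) * x - x ≡ x
  double = solve-∀ ℚ-ring

∣sgn∣ : ∀ n → ∣ sgn n ∣ ≡ 1ℚ
∣sgn∣ zero    = refl
∣sgn∣ (suc n) = trans (∣-p∣≡∣p∣ (sgn n)) (∣sgn∣ n)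

sgn-+ : ∀ a b → sgn (a ℕ.+ b) ≡ sgn a * sgn b
sgn-+ zero    b = sym (*-identityˡ (sgn b))
sgn-+ (suc a) b = trans (cong -_ (sgn-+ a b)) (neg-distribˡ-* (sgn a) (sgn b))

sumTo-cong : ∀ N {f g : ℕ → ℚ} → (∀ j → f j ≡ g j) → sumTo N f ≡ sumTo N g
sumTo-cong zero    f≡g = refl
sumTo-cong (suc N) f≡g = cong₂ _+_ (sumTo-cong N f≡g) (f≡g N)

sumTo-nonneg : ∀ {f} → (∀ j → 0ℚ ≤ f j) → ∀ N → 0ℚ ≤ sumTo N f
sumTo-nonneg 0≤f zero    = ≤-refl
sumTo-nonneg 0≤f (suc N) = 0≤+ (sumTo-nonneg 0≤f N) (0≤f N)

sumTo-sub : ∀ N f g → sumTo N (λ j → f j - g j) ≡ sumTo N f - sumTo N g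
sumTo-sub zero    f g = refl
sumTo-sub (suc N) f g = trans (cong (_+ (f N - g N)) (sumTo-sub N f g)) (regroup (sumTo N f) (sumTo N g) (f N) (g N))
  where
  regroup : ∀ a b x y → (a - b) + (x - y) ≡ (a + x) - (b + y)
  regroup = solve-∀ ℚ-ring

sumTo-scale : ∀ N a f → sumTo N (λ j → a * f j) ≡ a * sumTo N f
sumTo-scale zero    a f = sym (*-zeroʳ a)
sumTo-scale (suc N) a f = trans (cong (_+ a * f N) (sumTo-scale N a f)) (sym (*-distribˡ-+ a (sumTo N f) (f N)))

sumTo-split : ∀ d p f → sumTo (d ℕ.+ p) f ≡ sumTo p f + sumTo d (λ j → f (j ℕ.+ p))
sumTo-split zero    p f = sym (+-identityʳ (sumTo p f))
sumTo-split (suc d) p f = trans (cong (_+ f (d ℕ.+ p)) (sumTo-split d p f))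
  (+-assoc (sumTo p f) (sumTo d (λ j → f (j ℕ.+ p))) (f (d ℕ.+ p)))

sumTo-cons : ∀ N f → sumTo (suc N) f ≡ f 0 + sumTo N (λ j → f (suc j))
sumTo-cons zero    f = +-comm 0ℚ (f 0)
sumTo-cons (suc N) f = trans (cong (_+ f (suc N)) (sumTo-cons N f)) (+-assoc (f 0) (sumTo N (λ j → f (suc j))) (f (suc N)))

E : (ℕ → ℚ) → ℕ → ℚ
E f j = f (suc j)

Δ : (ℕ → ℚ) → ℕ → ℚ
Δ f j = f j - f (suc j)

shift : ℕ → (ℕ → ℚ) → ℕ → ℚ
shift p f j = f (j ℕ.+ p)

-- diff n f = ((1 - E)ⁿ f)(0) = Σ_j (-1)^j (n choose j) f j, the coefficients
-- of Euler's transformation of the alternating series Σ (-1)^j f j.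
diff : ℕ → (ℕ → ℚ) → ℚ
diff zero    f = f 0
diff (suc n) f = diff n f - diff n (E f)

diff-cong : ∀ n {f g : ℕ → ℚ} → (∀ j → f j ≡ g j) → diff n f ≡ diff n g
diff-cong zero    f≡g = f≡g 0
diff-cong (suc n) f≡g = cong₂ _-_ (diff-cong n f≡g) (diff-cong n (λ j → f≡g (suc j)))

diff-sub : ∀ n f g → diff n (λ j → f j - g j) ≡ diff n f - diff n g
diff-sub zero    f g = refl
diff-sub (suc n) f g = trans (cong₂ _-_ (diff-sub n f g) (diff-sub n (E f) (E g)))
  (regroup (diff n f) (diff n g) (diff n (E f)) (diff n (E g)))
  where
  regroup : ∀ a b c d → (a - b) - (c - d) ≡ (a - c) - (b - d)
  regroup = solve-∀ ℚ-ring

diff-Δ : ∀ n f → diff n (Δ f) ≡ diff (suc n) f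
diff-Δ n f = diff-sub n f (E f)

diff-affine-weight : ∀ (M : ℚ) n (x : ℚ) (f g : ℕ → ℚ) → (∀ j → (M * ι j + x) * f j ≡ g j) →
  (M * ι (suc n) + x) * diff (suc n) f ≡ M * ι (suc n) * diff n f + diff (suc n) g
diff-affine-weight M zero x f g weight = begin
  (M * 1ℚ + x) * (f 0 - f 1)                                   ≡⟨ expand M x (f 0) (f 1) ⟩
  M * 1ℚ * f 0 + ((M * 0ℚ + x) * f 0 - (M * 1ℚ + x) * f 1)   ≡⟨ cong₂ (λ u v → M * 1ℚ * f 0 + (u - v)) (weight 0) (weight 1) ⟩
  M * 1ℚ * f 0 + (g 0 - g 1)                                   ∎
  where
  open ≡-Reasoning
  expand : ∀ M x a b → (M * 1ℚ + x) * (a - b) ≡ M * 1ℚ * a + ((M * 0ℚ + x) * a - (M * 1ℚ + x) * b)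
  expand = solve-∀ ℚ-ring
diff-affine-weight M (suc n) x f g weight = begin
  (M * ι (suc (suc n)) + x) * (A - A′ - Bf)
    ≡⟨ cong (λ z → (M * z + x) * (A - A′ - Bf)) (ι-suc (suc n)) ⟩
  (M * (1ℚ + t) + x) * (A - A′ - Bf)
    ≡⟨ expand M t x A A′ Bf ⟩
  M * (1ℚ + t) * (A - A′) + (((M * t + x) * (A - A′) - M * t * A) - ((M * t + (x + M)) * Bf - M * t * A′))
    ≡⟨ cong₂ (λ u v → M * (1ℚ + t) * (A - A′) + (u - v)) (sym (solve-for (diff-affine-weight M n x f g weight)))
         (sym (solve-for (diff-affine-weight M n (x + M) (E f) (E g) shifted-weight))) ⟩
  M * (1ℚ + t) * (A - A′) + (diff (suc n) g - diff (suc n) (E g))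
    ≡⟨ cong (λ z → M * z * (A - A′) + diff (suc (suc n)) g) (sym (ι-suc (suc n))) ⟩
  M * ι (suc (suc n)) * diff (suc n) f + diff (suc (suc n)) g ∎
  where
  open ≡-Reasoning
  t  = ι (suc n)
  A  = diff n f
  A′ = diff n (E f)
  Bf = diff (suc n) (E f)
  expand : ∀ M t x A A′ Bf → (M * (1ℚ + t) + x) * ((A - A′) - Bf) ≡
    M * (1ℚ + t) * (A - A′) + (((M * t + x) * (A - A′) - M * t * A) - ((M * t + (x + M)) * Bf - M * t * A′))
  expand = solve-∀ ℚ-ring
  solve-for : ∀ {a b c} → a ≡ b + c → c ≡ a - b
  solve-for {a} {b} {c} a≡b+c = trans (sym (cancel c b)) (cong (_- b) (sym a≡b+c))
    where
    cancel : ∀ c b → b + c - b ≡ c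
    cancel = solve-∀ ℚ-ring
  shift-weight : ∀ j → M * ι (suc j) + x ≡ M * ι j + (x + M)
  shift-weight j = trans (cong (λ z → M * z + x) (ι-suc j)) (reassoc M (ι j) x)
    where
    reassoc : ∀ M t x → M * (1ℚ + t) + x ≡ M * t + (x + M)
    reassoc = solve-∀ ℚ-ring
  shifted-weight : ∀ j → (M * ι j + (x + M)) * f (suc j) ≡ g (suc j)
  shifted-weight j = trans (cong (_* f (suc j)) (sym (shift-weight j))) (weight (suc j))

invPow : ℕ → ℕ → ℕ → ℕ → ℚ
invPow m i k j = pow (inv (m ℕ.* j ℕ.+ i)) k

-- prefactor n = m^n n! / ∏_{j ≤ n} (m j + i).
prefactor : ℕ → ℕ → ℕ → ℚ
prefactor m i zero    = inv i
prefactor m i (suc n) = ι (m ℕ.* suc n) * inv (m ℕ.* suc n ℕ.+ i) * prefactor m i n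

1≤affine : ∀ m j i → 1 ℕ.≤ i → 1 ℕ.≤ m ℕ.* j ℕ.+ i
1≤affine m j i 1≤i = ℕP.≤-trans 1≤i (ℕP.m≤n+m i (m ℕ.* j))

invPow-step : ∀ m i → 1 ℕ.≤ i → ∀ k j → (ι m * ι j + ι i) * invPow m i (suc k) j ≡ invPow m i k j
invPow-step m i 1≤i k j = begin
  (ι m * ι j + ι i) * (inv w * invPow m i k j)  ≡⟨ cong (_* (inv w * invPow m i k j)) (sym (ι-affine m j i)) ⟩
  ι w * (inv w * invPow m i k j)                ≡⟨ sym (*-assoc (ι w) (inv w) (invPow m i k j)) ⟩
  ι w * inv w * invPow m i k j                  ≡⟨ cong (_* invPow m i k j) (ι*inv w (1≤affine m j i 1≤i)) ⟩
  1ℚ * invPow m i k j                           ≡⟨ *-identityˡ _ ⟩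
  invPow m i k j                                ∎
  where
  open ≡-Reasoning
  w = m ℕ.* j ℕ.+ i

diff-invPow-step : ∀ m i → 1 ℕ.≤ i → ∀ k n →
  ι (m ℕ.* suc n ℕ.+ i) * diff (suc n) (invPow m i (suc k))
    ≡ ι (m ℕ.* suc n) * diff n (invPow m i (suc k)) + diff (suc n) (invPow m i k)
diff-invPow-step m i 1≤i k n = begin
  ι (m ℕ.* suc n ℕ.+ i) * diff (suc n) f
    ≡⟨ cong (_* diff (suc n) f) (ι-affine m (suc n) i) ⟩
  (ι m * ι (suc n) + ι i) * diff (suc n) f
    ≡⟨ diff-affine-weight (ι m) n (ι i) f (invPow m i k) (invPow-step m i 1≤i k) ⟩
  ι m * ι (suc n) * diff n f + diff (suc n) (invPow m i k)
    ≡⟨ cong (λ z → z * diff n f + diff (suc n) (invPow m i k)) (sym (ι-* m (suc n))) ⟩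
  ι (m ℕ.* suc n) * diff n f + diff (suc n) (invPow m i k) ∎
  where
  open ≡-Reasoning
  f = invPow m i (suc k)

divide : ∀ {w y K} → 1 ℕ.≤ w → ι w * y ≡ K → y ≡ inv w * K
divide {w} {y} {K} 1≤w wy≡K = begin
  y                  ≡⟨ sym (*-identityˡ y) ⟩
  1ℚ * y             ≡⟨ cong (_* y) (sym (inv*ι w 1≤w)) ⟩
  inv w * ι w * y    ≡⟨ *-assoc (inv w) (ι w) y ⟩
  inv w * (ι w * y)  ≡⟨ cong (inv w *_) wy≡K ⟩
  inv w * K          ∎
  where open ≡-Reasoning

diff-invPow : ∀ m i → 1 ℕ.≤ i → ∀ k n → diff n (invPow m i (suc k)) ≡ prefactor m i n * B m i n k
diff-invPow m i 1≤i zero zero = cong (λ z → inv (z ℕ.+ i) * 1ℚ) (ℕP.*-zeroʳ m)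
diff-invPow m i 1≤i zero (suc n) = begin
  diff (suc n) (invPow m i 1)
    ≡⟨ divide (1≤affine m (suc n) i 1≤i) (diff-invPow-step m i 1≤i zero n) ⟩
  inv w * (a * diff n (invPow m i 1) + diff (suc n) (λ _ → 1ℚ))
    ≡⟨ cong₂ (λ u v → inv w * (a * u + v)) (diff-invPow m i 1≤i zero n) (+-inverseʳ (diff n (λ _ → 1ℚ))) ⟩
  inv w * (a * (prefactor m i n * 1ℚ) + 0ℚ)
    ≡⟨ regroup a (inv w) (prefactor m i n) ⟩
  a * inv w * prefactor m i n * 1ℚ ∎
  where
  open ≡-Reasoning
  w = m ℕ.* suc n ℕ.+ i
  a = ι (m ℕ.* suc n)
  regroup : ∀ a I u → I * (a * (u * 1ℚ) + 0ℚ) ≡ a * I * u * 1ℚ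
  regroup = solve-∀ ℚ-ring
diff-invPow m i 1≤i (suc k) zero = begin
  inv i₀ * diff 0 (invPow m i (suc k))  ≡⟨ cong (inv i₀ *_) (diff-invPow m i 1≤i k zero) ⟩
  inv i₀ * (inv i * B m i 0 k)          ≡⟨ regroup (inv i₀) (inv i) (B m i 0 k) ⟩
  inv i * (0ℚ + inv i₀ * B m i 0 k)     ∎
  where
  open ≡-Reasoning
  i₀ = m ℕ.* 0 ℕ.+ i
  regroup : ∀ a b c → a * (b * c) ≡ b * (0ℚ + a * c)
  regroup = solve-∀ ℚ-ring
diff-invPow m i 1≤i (suc k) (suc n) = begin
  diff (suc n) (invPow m i (suc (suc k)))
    ≡⟨ divide (1≤affine m (suc n) i 1≤i) (diff-invPow-step m i 1≤i (suc k) n) ⟩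
  inv w * (a * diff n (invPow m i (suc (suc k))) + diff (suc n) (invPow m i (suc k)))
    ≡⟨ cong₂ (λ u v → inv w * (a * u + v)) (diff-invPow m i 1≤i (suc k) n) (diff-invPow m i 1≤i k (suc n)) ⟩
  inv w * (a * (prefactor m i n * B m i n (suc k)) + a * inv w * prefactor m i n * B m i (suc n) k)
    ≡⟨ regroup a (inv w) (prefactor m i n) (B m i n (suc k)) (B m i (suc n) k) ⟩
  a * inv w * prefactor m i n * (B m i n (suc k) + inv w * B m i (suc n) k) ∎
  where
  open ≡-Reasoning
  w = m ℕ.* suc n ℕ.+ i
  a = ι (m ℕ.* suc n)
  regroup : ∀ a I u b b′ → I * (a * (u * b) + a * I * u * b′) ≡ a * I * u * (b + I * b′)
  regroup = solve-∀ ℚ-ring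

B-nonneg : ∀ m i n k → 0ℚ ≤ B m i n k
B-nonneg m i n zero    = nonNegative⁻¹ 1ℚ
B-nonneg m i n (suc k) = sumTo-nonneg (λ j → 0≤* (0≤inv (m ℕ.* j ℕ.+ i)) (B-nonneg m i j k)) (suc n)

prefactor-nonneg : ∀ m i n → 0ℚ ≤ prefactor m i n
prefactor-nonneg m i zero    = 0≤inv i
prefactor-nonneg m i (suc n) =
  0≤* (0≤* (0≤ι (m ℕ.* suc n)) (0≤inv (m ℕ.* suc n ℕ.+ i))) (prefactor-nonneg m i n)

rhsDenominator : ℕ → ℕ → ℕ → ℚ
rhsDenominator m i n = ι (2 ℕ.^ suc n) * ι m * rising (ι i * inv m) (suc n)

-- prefactor n · 2^{-(n+1)} · rhsDenominator n = n!, since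
-- m (i/m)_{n+1} = ∏_{j ≤ n} (m j + i) / m^n.
prefactor-rhsDenominator : ∀ m i → 1 ℕ.≤ m → 1 ℕ.≤ i → ∀ n →
  prefactor m i n * pow ½ (suc n) * rhsDenominator m i n ≡ ι (n ℕ.!)
prefactor-rhsDenominator m i 1≤m 1≤i zero = begin
  inv i * (½ * 1ℚ) * (ι 2 * ι m * (1ℚ * (ι i * inv m + 0ℚ)))  ≡⟨ regroup (inv i) ½ (ι 2) (ι m) (ι i) (inv m) ⟩
  ½ * ι 2 * (ι i * inv i * (ι m * inv m))                     ≡⟨ cong₂ (λ u v → ½ * ι 2 * (u * v)) (ι*inv i 1≤i) (ι*inv m 1≤m) ⟩
  1ℚ                                                          ∎
  where
  open ≡-Reasoning
  regroup : ∀ I h t M Ii J → I * (h * 1ℚ) * (t * M * (1ℚ * (Ii * J + 0ℚ))) ≡ h * t * (Ii * I * (M * J))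
  regroup = solve-∀ ℚ-ring
prefactor-rhsDenominator m i 1≤m 1≤i (suc n) = begin
  prefactor m i (suc n) * pow ½ (suc (suc n)) * rhsDenominator m i (suc n)
    ≡⟨ cong₂ (λ u v → u * inv w * prefactor m i n * pow ½ (suc (suc n)) * (v * ι m * (rising a (suc n) * (a + s))))
        (ι-* m (suc n)) (ι-* 2 (2 ℕ.^ suc n)) ⟩
  ι m * s * inv w * prefactor m i n * (½ * pow ½ (suc n)) * (ι 2 * P * ι m * (rising a (suc n) * (a + s)))
    ≡⟨ regroup (ι m) s (inv w) (prefactor m i n) ½ (pow ½ (suc n)) (ι 2) P (rising a (suc n)) a ⟩
  prefactor m i n * pow ½ (suc n) * rhsDenominator m i n * (½ * ι 2) * (s * (inv w * (ι m * a + ι m * s)))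
    ≡⟨ cong₂ (λ u v → u * (½ * ι 2) * (s * (inv w * (v + ι m * s))))
        (prefactor-rhsDenominator m i 1≤m 1≤i n) m·i/m≡i ⟩
  ι (n ℕ.!) * 1ℚ * (s * (inv w * (ι i + ι m * s)))
    ≡⟨ cong (λ z → ι (n ℕ.!) * 1ℚ * (s * (inv w * z))) (trans (+-comm (ι i) (ι m * s)) (sym (ι-affine m (suc n) i))) ⟩
  ι (n ℕ.!) * 1ℚ * (s * (inv w * ι w))
    ≡⟨ cong (λ z → ι (n ℕ.!) * 1ℚ * (s * z)) (inv*ι w (1≤affine m (suc n) i 1≤i)) ⟩
  ι (n ℕ.!) * 1ℚ * (s * 1ℚ)
    ≡⟨ simplify (ι (n ℕ.!)) s ⟩
  s * ι (n ℕ.!)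
    ≡⟨ sym (ι-* (suc n) (n ℕ.!)) ⟩
  ι (suc n ℕ.!) ∎
  where
  open ≡-Reasoning
  w = m ℕ.* suc n ℕ.+ i
  s = ι (suc n)
  a = ι i * inv m
  P = ι (2 ℕ.^ suc n)
  m·i/m≡i : ι m * a ≡ ι i
  m·i/m≡i = trans (*-assoc-swap (ι m) (ι i) (inv m)) (trans (cong (ι i *_) (ι*inv m 1≤m)) (*-identityʳ (ι i)))
    where
    *-assoc-swap : ∀ M I J → M * (I * J) ≡ I * (M * J)
    *-assoc-swap = solve-∀ ℚ-ring
  regroup : ∀ M s I u h p t P ρ a → M * s * I * u * (h * p) * (t * P * M * (ρ * (a + s))) ≡
    u * p * (P * M * ρ) * (h * t) * (s * (I * (M * a + M * s)))
  regroup = solve-∀ ℚ-ring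
  simplify : ∀ N s → N * 1ℚ * (s * 1ℚ) ≡ s * N
  simplify = solve-∀ ℚ-ring

0<rhsDenominator : ∀ m i → 1 ℕ.≤ m → 1 ℕ.≤ i → ∀ n → 0ℚ < rhsDenominator m i n
0<rhsDenominator (suc m) (suc i) _ _ n =
  0<* (0<* (0<2^ (suc n)) (0<ι m)) (0<rising (0<* (0<ι i) (0<inv m)) (suc n))
  where
  0<2^ : ∀ n → 0ℚ < ι (2 ℕ.^ n)
  0<2^ zero    = 0<ι 0
  0<2^ (suc n) = subst (0ℚ <_) (sym (ι-* 2 (2 ℕ.^ n))) (0<* (0<ι 1) (0<2^ n))
  0<rising : ∀ {a} → 0ℚ < a → ∀ n → 0ℚ < rising a n
  0<rising 0<a zero    = positive⁻¹ 1ℚ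
  0<rising 0<a (suc n) = 0<* (0<rising 0<a n) (+-mono-<-≤ 0<a (0≤ι n))

rhsTerm≡euler : ∀ m i k → 1 ℕ.≤ m → 1 ℕ.≤ i → ∀ n →
  rhsTerm m i (suc k) n ≡ diff n (invPow m i (suc k)) * pow ½ (suc n)
rhsTerm≡euler m i k 1≤m 1≤i n = begin
  ι (n ℕ.!) * rec R * B m i n k
    ≡⟨ cong (λ z → z * rec R * B m i n k) (sym (prefactor-rhsDenominator m i 1≤m 1≤i n)) ⟩
  U * pow ½ (suc n) * R * rec R * B m i n k
    ≡⟨ regroup U (pow ½ (suc n)) R (rec R) (B m i n k) ⟩
  U * B m i n k * pow ½ (suc n) * (R * rec R)
    ≡⟨ cong (λ z → U * B m i n k * pow ½ (suc n) * z) (*-rec R (0<rhsDenominator m i 1≤m 1≤i n)) ⟩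
  U * B m i n k * pow ½ (suc n) * 1ℚ
    ≡⟨ *-identityʳ _ ⟩
  U * B m i n k * pow ½ (suc n)
    ≡⟨ cong (_* pow ½ (suc n)) (sym (diff-invPow m i 1≤i k n)) ⟩
  diff n (invPow m i (suc k)) * pow ½ (suc n) ∎
  where
  open ≡-Reasoning
  R = rhsDenominator m i n
  U = prefactor m i n
  regroup : ∀ U p R r B → U * p * R * r * B ≡ U * B * p * (R * r)
  regroup = solve-∀ ℚ-ring

altSum : ℕ → (ℕ → ℚ) → ℚ
altSum N f = sumTo N (λ j → sgn j * f j)

eulerSum : ℕ → (ℕ → ℚ) → ℚ
eulerSum N f = sumTo N (λ n → diff n f * pow ½ (suc n))

eulerError : ℕ → (ℕ → ℚ) → ℚ
eulerError N f = altSum N f - eulerSum N f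

altSum-cons : ∀ N f → altSum (suc N) f ≡ f 0 - altSum N (E f)
altSum-cons N f = begin
  altSum (suc N) f                                          ≡⟨ sumTo-cons N (λ j → sgn j * f j) ⟩
  1ℚ * f 0 + sumTo N (λ j → - sgn j * f (suc j))            ≡⟨ cong (λ z → 1ℚ * f 0 + z) (sumTo-cong N (λ j → neg-out (sgn j) (f (suc j)))) ⟩
  1ℚ * f 0 + sumTo N (λ j → - 1ℚ * (sgn j * f (suc j)))    ≡⟨ cong (λ z → 1ℚ * f 0 + z) (sumTo-scale N (- 1ℚ) (λ j → sgn j * f (suc j))) ⟩
  1ℚ * f 0 + - 1ℚ * altSum N (E f)                          ≡⟨ simplify (f 0) (altSum N (E f)) ⟩
  f 0 - altSum N (E f)                                      ∎
  where
  open ≡-Reasoning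
  neg-out : ∀ s x → - s * x ≡ - 1ℚ * (s * x)
  neg-out = solve-∀ ℚ-ring
  simplify : ∀ x y → 1ℚ * x + - 1ℚ * y ≡ x - y
  simplify = solve-∀ ℚ-ring

altSum-Δ : ∀ N f → altSum N (Δ f) ≡ altSum N f - altSum N (E f)
altSum-Δ N f = trans (sumTo-cong N (λ j → *-distribˡ-minus (sgn j) (f j) (f (suc j))))
  (sumTo-sub N (λ j → sgn j * f j) (λ j → sgn j * f (suc j)))
  where
  *-distribˡ-minus : ∀ s a b → s * (a - b) ≡ s * a - s * b
  *-distribˡ-minus = solve-∀ ℚ-ring

eulerSum-cons : ∀ N f → eulerSum (suc N) f ≡ f 0 * (½ * 1ℚ) + ½ * eulerSum N (Δ f)
eulerSum-cons N f = begin
  eulerSum (suc N) f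
    ≡⟨ sumTo-cons N (λ n → diff n f * pow ½ (suc n)) ⟩
  f 0 * (½ * 1ℚ) + sumTo N (λ n → diff (suc n) f * (½ * pow ½ (suc n)))
    ≡⟨ cong (λ z → f 0 * (½ * 1ℚ) + z) (sumTo-cong N (λ n → trans (swap (diff (suc n) f) ½ (pow ½ (suc n)))
         (cong (λ z → ½ * (z * pow ½ (suc n))) (sym (diff-Δ n f))))) ⟩
  f 0 * (½ * 1ℚ) + sumTo N (λ n → ½ * (diff n (Δ f) * pow ½ (suc n)))
    ≡⟨ cong (λ z → f 0 * (½ * 1ℚ) + z) (sumTo-scale N ½ (λ n → diff n (Δ f) * pow ½ (suc n))) ⟩
  f 0 * (½ * 1ℚ) + ½ * eulerSum N (Δ f) ∎
  where
  open ≡-Reasoning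
  swap : ∀ a h p → a * (h * p) ≡ h * (a * p)
  swap = solve-∀ ℚ-ring

eulerError-step : ∀ N f → eulerError (suc N) f ≡ ½ * (eulerError N (Δ f) + sgn N * f N)
eulerError-step N f = begin
  (X + s) - eulerSum (suc N) f
    ≡⟨ cong (λ z → (X + s) - z) (eulerSum-cons N f) ⟩
  (X + s) - (f 0 * (½ * 1ℚ) + ½ * eulerSum N (Δ f))
    ≡⟨ regroup ½ X s (f 0) (eulerSum N (Δ f)) ⟩
  ½ * (X - (f 0 - (X + s)) - eulerSum N (Δ f) + s) + 0ℚ * (X + s)
    ≡⟨ cong (λ z → ½ * (X - (f 0 - (X + s)) - eulerSum N (Δ f) + s) + z) (*-zeroˡ (X + s)) ⟩
  ½ * (X - (f 0 - (X + s)) - eulerSum N (Δ f) + s) + 0ℚ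
    ≡⟨ +-identityʳ _ ⟩
  ½ * (X - (f 0 - (X + s)) - eulerSum N (Δ f) + s)
    ≡⟨ cong (λ z → ½ * (X - z - eulerSum N (Δ f) + s)) (sym shifted) ⟩
  ½ * (X - altSum N (E f) - eulerSum N (Δ f) + s)
    ≡⟨ cong (λ z → ½ * (z - eulerSum N (Δ f) + s)) (sym (altSum-Δ N f)) ⟩
  ½ * (eulerError N (Δ f) + sgn N * f N) ∎
  where
  open ≡-Reasoning
  X = altSum N f
  s = sgn N * f N
  regroup : ∀ h X s f₀ T → (X + s) - (f₀ * (h * 1ℚ) + h * T) ≡
    h * ((X - (f₀ - (X + s))) - T + s) + (1ℚ - (h + h)) * (X + s)
  regroup = solve-∀ ℚ-ring
  cancel : ∀ b y → b - (b - y) ≡ y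
  cancel = solve-∀ ℚ-ring
  shifted : altSum N (E f) ≡ f 0 - (X + s)
  shifted = trans (sym (cancel (f 0) (altSum N (E f)))) (cong (λ z → f 0 - z) (sym (altSum-cons N f)))

-- The majorant of the error: M_0 f = 0 and
--   M_{N+1} f = ½ (M_N f + M_N (E f) + 2^{-N} f N).
-- For completely monotone f it bounds ∣D_N f∣, and it is linear and monotone in f.
majorant : ℕ → (ℕ → ℚ) → ℚ
majorant zero    f = 0ℚ
majorant (suc N) f = ½ * (majorant N f + majorant N (E f) + pow ½ N * f N)

majorant-sub : ∀ N f g → majorant N (λ j → f j - g j) ≡ majorant N f - majorant N g
majorant-sub zero    f g = refl
majorant-sub (suc N) f g =
  trans (cong₂ (λ u v → ½ * (u + v + pow ½ N * (f N - g N))) (majorant-sub N f g) (majorant-sub N (E f) (E g)))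
    (regroup ½ (majorant N f) (majorant N g) (majorant N (E f)) (majorant N (E g)) (pow ½ N) (f N) (g N))
  where
  regroup : ∀ h a b a′ b′ p x y → h * ((a - b) + (a′ - b′) + p * (x - y)) ≡ h * (a + a′ + p * x) - h * (b + b′ + p * y)
  regroup = solve-∀ ℚ-ring

majorant-add : ∀ N f g → majorant N (λ j → f j + g j) ≡ majorant N f + majorant N g
majorant-add zero    f g = refl
majorant-add (suc N) f g =
  trans (cong₂ (λ u v → ½ * (u + v + pow ½ N * (f N + g N))) (majorant-add N f g) (majorant-add N (E f) (E g)))
    (regroup ½ (majorant N f) (majorant N g) (majorant N (E f)) (majorant N (E g)) (pow ½ N) (f N) (g N))
  where
  regroup : ∀ h a b a′ b′ p x y → h * ((a + b) + (a′ + b′) + p * (x + y)) ≡ h * (a + a′ + p * x) + h * (b + b′ + p * y)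
  regroup = solve-∀ ℚ-ring

majorant-scale : ∀ N a f → majorant N (λ j → a * f j) ≡ a * majorant N f
majorant-scale zero    a f = sym (*-zeroʳ a)
majorant-scale (suc N) a f =
  trans (cong₂ (λ u v → ½ * (u + v + pow ½ N * (a * f N))) (majorant-scale N a f) (majorant-scale N a (E f)))
    (regroup ½ a (majorant N f) (majorant N (E f)) (pow ½ N) (f N))
  where
  regroup : ∀ h a u v p x → h * (a * u + a * v + p * (a * x)) ≡ a * (h * (u + v + p * x))
  regroup = solve-∀ ℚ-ring

majorant-mono : ∀ N {f g : ℕ → ℚ} → (∀ j → f j ≤ g j) → majorant N f ≤ majorant N g
majorant-mono zero    f≤g = ≤-refl
majorant-mono (suc N) f≤g = scale-≤ (nonNegative⁻¹ ½)
  (+-mono-≤ (+-mono-≤ (majorant-mono N f≤g) (majorant-mono N (λ j → f≤g (suc j))))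
    (scale-≤ (pow-nonneg (nonNegative⁻¹ ½) N) (f≤g N)))

0≤1-½^ : ∀ n → 0ℚ ≤ 1ℚ - pow ½ n
0≤1-½^ n = ≤⇒0≤- (pow≤1 (nonNegative⁻¹ ½) (*≤* (ℤ.+≤+ (ℕ.s≤s ℕ.z≤n))) n)

majorant-lower : ∀ n g → (∀ j → 0ℚ ≤ g j) → (∀ j → g (suc j) ≤ g j) →
  (1ℚ - pow ½ (suc n)) * g n ≤ majorant (suc n) g
majorant-lower zero g 0≤g g↓ = ≤-reflexive (trans (regroup ½ (g 0))
  (trans (cong (λ z → ½ * (0ℚ + 0ℚ + 1ℚ * g 0) + z) (*-zeroˡ (g 0))) (+-identityʳ _)))
  where
  regroup : ∀ h x → (1ℚ - h * 1ℚ) * x ≡ h * (0ℚ + 0ℚ + 1ℚ * x) + (1ℚ - (h + h)) * x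
  regroup = solve-∀ ℚ-ring
majorant-lower (suc n) g 0≤g g↓ = 0≤-⇒≤ (subst (0ℚ ≤_) (sym split) nonneg)
  where
  p  = pow ½ (suc n)
  M₁ = majorant (suc n) g
  M₂ = majorant (suc n) (E g)
  X  = ½ * ((M₁ - (1ℚ - p) * g n) + (M₂ - (1ℚ - p) * g (suc n)) + (1ℚ - p) * (g n - g (suc n)))
  regroup : ∀ h p M₁ M₂ g₀ g₁ → h * (M₁ + M₂ + p * g₁) - (1ℚ - h * p) * g₁ ≡
    h * ((M₁ - (1ℚ - p) * g₀) + (M₂ - (1ℚ - p) * g₁) + (1ℚ - p) * (g₀ - g₁)) + ((h + h) - 1ℚ) * g₁
  regroup = solve-∀ ℚ-ring
  split : majorant (suc (suc n)) g - (1ℚ - ½ * p) * g (suc n) ≡ X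
  split = trans (regroup ½ p M₁ M₂ (g n) (g (suc n))) (trans (cong (λ z → X + z) (*-zeroˡ (g (suc n)))) (+-identityʳ X))
  nonneg : 0ℚ ≤ X
  nonneg = 0≤* (nonNegative⁻¹ ½) (0≤+ (0≤+ (≤⇒0≤- (majorant-lower n g 0≤g g↓))
             (≤⇒0≤- (majorant-lower n (E g) (λ j → 0≤g (suc j)) (λ j → g↓ (suc j)))))
           (0≤* (0≤1-½^ (suc n)) (≤⇒0≤- (g↓ n))))

record CompletelyMonotone (f : ℕ → ℚ) : Set where
  constructor completelyMonotone
  field diff-nonneg : ∀ r p → 0ℚ ≤ diff r (shift p f)
open CompletelyMonotone

CM-nonneg : ∀ {f} → CompletelyMonotone f → ∀ j → 0ℚ ≤ f j
CM-nonneg cm j = diff-nonneg cm 0 j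

CM-decreasing : ∀ {f} → CompletelyMonotone f → ∀ j → f (suc j) ≤ f j
CM-decreasing cm j = 0≤-⇒≤ (diff-nonneg cm 1 j)

CM-antitone : ∀ {f} → CompletelyMonotone f → ∀ {a b} → a ℕ.≤ b → f b ≤ f a
CM-antitone {f} cm {a} {b} a≤b = subst (λ z → f z ≤ f a) (ℕP.m∸n+n≡m a≤b) (go (b ℕ.∸ a))
  where
  go : ∀ d → f (d ℕ.+ a) ≤ f a
  go zero    = ≤-refl
  go (suc d) = ≤-trans (CM-decreasing cm (d ℕ.+ a)) (go d)

CM-Δ : ∀ {f} → CompletelyMonotone f → CompletelyMonotone (Δ f)
CM-Δ {f} cm = completelyMonotone (λ r p → subst (0ℚ ≤_) (sym (diff-Δ r (shift p f))) (diff-nonneg cm (suc r) p))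

twice-shifted-majorant : ∀ N f → CompletelyMonotone f →
  0ℚ ≤ (majorant N (E f) + majorant N (E f)) - (1ℚ - pow ½ N) * f N
twice-shifted-majorant zero    f cm = ≤-reflexive (sym (vanish (f 0)))
  where
  vanish : ∀ x → (0ℚ + 0ℚ) - (1ℚ - 1ℚ) * x ≡ 0ℚ
  vanish = solve-∀ ℚ-ring
twice-shifted-majorant (suc n) f cm =
  subst (0ℚ ≤_) (sym (regroup (majorant (suc n) (E f)) (1ℚ - pow ½ (suc n)) (f (suc n))))
    (0≤+ (0≤+ (≤⇒0≤- lower) (≤⇒0≤- lower)) (0≤* (0≤1-½^ (suc n)) (CM-nonneg cm (suc n))))
  where
  regroup : ∀ w a x → (w + w) - a * x ≡ (w - a * x) + (w - a * x) + a * x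
  regroup = solve-∀ ℚ-ring
  lower : (1ℚ - pow ½ (suc n)) * f (suc n) ≤ majorant (suc n) (E f)
  lower = majorant-lower n (E f) (λ j → CM-nonneg cm (suc j)) (λ j → CM-decreasing cm (suc j))

-- Induction on N via the error recursion; the step needs M_N (Δ f) + f N ≤ 2 M_{N+1} f,
-- which by linearity of M is the inequality above.
eulerError-bound : ∀ N f → CompletelyMonotone f → ∣ eulerError N f ∣ ≤ majorant N f
eulerError-bound zero    f cm = ≤-refl
eulerError-bound (suc N) f cm = begin
  ∣ eulerError (suc N) f ∣        ≡⟨ trans (cong ∣_∣ (eulerError-step N f)) (∣p*q∣≡∣p∣*∣q∣ ½ (D′ + s)) ⟩
  ½ * ∣ D′ + s ∣                  ≤⟨ scale-≤ (nonNegative⁻¹ ½) (∣p+q∣≤∣p∣+∣q∣ D′ s) ⟩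
  ½ * (∣ D′ ∣ + ∣ s ∣)            ≤⟨ scale-≤ (nonNegative⁻¹ ½) (+-mono-≤ (eulerError-bound N (Δ f) (CM-Δ cm)) (≤-reflexive ∣s∣≡fN)) ⟩
  ½ * (majorant N (Δ f) + f N)    ≤⟨ step ⟩
  majorant (suc N) f              ∎
  where
  open ≤-Reasoning
  D′ = eulerError N (Δ f)
  s  = sgn N * f N
  ∣s∣≡fN : ∣ s ∣ ≡ f N
  ∣s∣≡fN = trans (∣p*q∣≡∣p∣*∣q∣ (sgn N) (f N)) (trans (cong (_* ∣ f N ∣) (∣sgn∣ N))
             (trans (*-identityˡ ∣ f N ∣) (0≤p⇒∣p∣≡p (CM-nonneg cm N))))
  regroup : ∀ h A A′ p x → h * (A + A′ + p * x) - h * ((A - A′) + x) ≡ h * ((A′ + A′) - (1ℚ - p) * x)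
  regroup = solve-∀ ℚ-ring
  step : ½ * (majorant N (Δ f) + f N) ≤ majorant (suc N) f
  step = subst (λ z → ½ * (z + f N) ≤ majorant (suc N) f) (sym (majorant-sub N f (E f)))
    (0≤-⇒≤ (subst (0ℚ ≤_) (sym (regroup ½ (majorant N f) (majorant N (E f)) (pow ½ N) (f N)))
      (0≤* (nonNegative⁻¹ ½) (twice-shifted-majorant N f cm))))

majorant-const : ∀ N a → majorant N (λ _ → a) ≡ (1ℚ - pow ½ N) * a
majorant-const zero    a = sym (*-zeroˡ a)
majorant-const (suc N) a = begin
  ½ * (majorant N (λ _ → a) + majorant N (λ _ → a) + pow ½ N * a)  ≡⟨ cong (λ z → ½ * (z + z + pow ½ N * a)) (majorant-const N a) ⟩
  ½ * ((1ℚ - pow ½ N) * a + (1ℚ - pow ½ N) * a + pow ½ N * a)      ≡⟨ regroup ½ (pow ½ N) a ⟩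
  (1ℚ - ½ * pow ½ N) * a + 0ℚ * a                                  ≡⟨ cong (λ z → (1ℚ - ½ * pow ½ N) * a + z) (*-zeroˡ a) ⟩
  (1ℚ - ½ * pow ½ N) * a + 0ℚ                                      ≡⟨ +-identityʳ _ ⟩
  (1ℚ - pow ½ (suc N)) * a                                         ∎
  where
  open ≡-Reasoning
  regroup : ∀ h p a → h * ((1ℚ - p) * a + (1ℚ - p) * a + p * a) ≡ (1ℚ - h * p) * a + ((h + h) - 1ℚ) * a
  regroup = solve-∀ ℚ-ring

¾ : ℚ
¾ = ½ * (1ℚ + ½)

¼ : ℚ
¼ = ½ * ½

majorant-geometric : ∀ N → majorant N (pow ½) ≡ pow ¾ N - pow ¼ N
majorant-geometric zero    = refl
majorant-geometric (suc N) = begin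
  ½ * (majorant N (pow ½) + majorant N (λ j → ½ * pow ½ j) + pow ½ N * pow ½ N)
    ≡⟨ cong₂ (λ u v → ½ * (majorant N (pow ½) + u + v)) (majorant-scale N ½ (pow ½)) (pow-* ½ ½ N) ⟩
  ½ * (majorant N (pow ½) + ½ * majorant N (pow ½) + pow ¼ N)
    ≡⟨ cong (λ z → ½ * (z + ½ * z + pow ¼ N)) (majorant-geometric N) ⟩
  ½ * ((pow ¾ N - pow ¼ N) + ½ * (pow ¾ N - pow ¼ N) + pow ¼ N)
    ≡⟨ regroup ½ (pow ¾ N) (pow ¼ N) ⟩
  pow ¾ (suc N) - pow ¼ (suc N) ∎
  where
  open ≡-Reasoning
  regroup : ∀ h A B → h * ((A - B) + h * (A - B) + B) ≡ (h * (1ℚ + h)) * A - (h * h) * B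
  regroup = solve-∀ ℚ-ring

majorant-bound : ∀ N K e f → 0ℚ ≤ K → 0ℚ ≤ e → (∀ j → f j ≤ K * pow ½ j + e) → majorant N f ≤ K * pow ¾ N + e
majorant-bound N K e f 0≤K 0≤e f≤ = begin
  majorant N f                                  ≤⟨ majorant-mono N f≤ ⟩
  majorant N (λ j → K * pow ½ j + e)            ≡⟨ trans (majorant-add N (λ j → K * pow ½ j) (λ _ → e))
                                                     (cong₂ _+_ (majorant-scale N K (pow ½)) (majorant-const N e)) ⟩
  K * majorant N (pow ½) + (1ℚ - pow ½ N) * e   ≤⟨ +-mono-≤ (scale-≤ 0≤K geometric≤) constant≤ ⟩
  K * pow ¾ N + e                               ∎
  where
  open ≤-Reasoning
  geometric≤ : majorant N (pow ½) ≤ pow ¾ N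
  geometric≤ = subst (_≤ pow ¾ N) (sym (majorant-geometric N)) (x-y≤x (pow-nonneg (nonNegative⁻¹ ¼) N))
  expand : ∀ p e → (1ℚ - p) * e ≡ e - p * e
  expand = solve-∀ ℚ-ring
  constant≤ : (1ℚ - pow ½ N) * e ≤ e
  constant≤ = subst (_≤ e) (sym (expand (pow ½ N) e)) (x-y≤x (0≤* (pow-nonneg (nonNegative⁻¹ ½) N) 0≤e))

¾^N*N≤3 : ∀ N → pow ¾ N * ι N ≤ ι 3
¾^N*N≤3 zero    = 0≤ι 3
¾^N*N≤3 (suc N) = begin
  ¾ * pow ¾ N * ι (suc N)          ≡⟨ cong (¾ * pow ¾ N *_) (ι-suc N) ⟩
  ¾ * pow ¾ N * (1ℚ + ι N)         ≡⟨ regroup ¾ (pow ¾ N) (ι N) ⟩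
  ¾ * (pow ¾ N * ι N + pow ¾ N)    ≤⟨ scale-≤ (nonNegative⁻¹ ¾) (+-mono-≤ (¾^N*N≤3 N) (pow≤1 (nonNegative⁻¹ ¾) ¾≤1 N)) ⟩
  ¾ * (ι 3 + 1ℚ)                   ≡⟨⟩
  ι 3                              ∎
  where
  open ≤-Reasoning
  regroup : ∀ a p n → a * p * (1ℚ + n) ≡ a * (p * n + p)
  regroup = solve-∀ ℚ-ring
  ¾≤1 : ¾ ≤ 1ℚ
  ¾≤1 = *≤* (ℤ.+≤+ (ℕ.s≤s (ℕ.s≤s (ℕ.s≤s ℕ.z≤n))))

leibniz : ∀ d g → (∀ j → 0ℚ ≤ g j) → (∀ j → g (suc j) ≤ g j) → (0ℚ ≤ altSum d g) × (altSum d g ≤ g 0)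
leibniz zero    g 0≤g g↓ = ≤-refl , 0≤g 0
leibniz (suc d) g 0≤g g↓ = subst (0ℚ ≤_) (sym (altSum-cons d g)) lower , subst (_≤ g 0) (sym (altSum-cons d g)) upper
  where
  tail = leibniz d (E g) (λ j → 0≤g (suc j)) (λ j → g↓ (suc j))
  lower : 0ℚ ≤ g 0 - altSum d (E g)
  lower = ≤-trans (≤⇒0≤- (g↓ 0)) (+-monoʳ-≤ (g 0) (neg-antimono-≤ (proj₂ tail)))
  upper : g 0 - altSum d (E g) ≤ g 0
  upper = x-y≤x (proj₁ tail)

altSum-split : ∀ d p f → altSum (d ℕ.+ p) f ≡ altSum p f + sgn p * altSum d (shift p f)
altSum-split d p f = trans (sumTo-split d p (λ j → sgn j * f j))
  (cong (λ z → altSum p f + z) (trans (sumTo-cong d (λ j → trans (cong (_* f (j ℕ.+ p)) (sgn-+ j p)) (swap (sgn j) (sgn p) (f (j ℕ.+ p)))))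
     (sumTo-scale d (sgn p) (λ j → sgn j * f (j ℕ.+ p)))))
  where
  swap : ∀ a b x → a * b * x ≡ b * (a * x)
  swap = solve-∀ ℚ-ring

altSum-tail : ∀ f → (∀ j → 0ℚ ≤ f j) → (∀ j → f (suc j) ≤ f j) → ∀ p d →
  ∣ altSum (d ℕ.+ p) f - altSum p f ∣ ≤ f p
altSum-tail f 0≤f f↓ p d = subst (_≤ f p) (sym tail≡) (proj₂ bounds)
  where
  bounds = leibniz d (shift p f) (λ j → 0≤f (j ℕ.+ p)) (λ j → f↓ (j ℕ.+ p))
  cancel : ∀ X Y → X + Y - X ≡ Y
  cancel = solve-∀ ℚ-ring
  tail≡ : ∣ altSum (d ℕ.+ p) f - altSum p f ∣ ≡ altSum d (shift p f)
  tail≡ = begin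
    ∣ altSum (d ℕ.+ p) f - altSum p f ∣                   ≡⟨ cong (λ z → ∣ z - altSum p f ∣) (altSum-split d p f) ⟩
    ∣ altSum p f + sgn p * altSum d (shift p f) - altSum p f ∣ ≡⟨ cong ∣_∣ (cancel (altSum p f) (sgn p * altSum d (shift p f))) ⟩
    ∣ sgn p * altSum d (shift p f) ∣                      ≡⟨ ∣p*q∣≡∣p∣*∣q∣ (sgn p) (altSum d (shift p f)) ⟩
    ∣ sgn p ∣ * ∣ altSum d (shift p f) ∣                  ≡⟨ cong₂ _*_ (∣sgn∣ p) (0≤p⇒∣p∣≡p (proj₁ bounds)) ⟩
    1ℚ * altSum d (shift p f)                             ≡⟨ *-identityˡ _ ⟩
    altSum d (shift p f)                                  ∎
    where open ≡-Reasoning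

archimedean : ∀ x → Σ ℕ (λ n → x < ι n)
archimedean (mkℚ (+ a) d c) = suc a , subst (mkℚ (+ a) d c <_) (sym (ι≡mkℚ (suc a))) (*<* cross)
  where
  a< : a ℕ.* 1 ℕ.< suc a ℕ.* suc d
  a< = subst (ℕ._< suc a ℕ.* suc d) (sym (ℕP.*-identityʳ a)) (ℕP.<-≤-trans (ℕP.n<1+n a) (ℕP.m≤m*n (suc a) (suc d)))
  cross : + a ℤ.* + 1 ℤ.< + suc a ℤ.* + suc d
  cross = subst₂ ℤ._<_ (ℤP.pos-* a 1) (ℤP.pos-* (suc a) (suc d)) (ℤ.+<+ a<)
archimedean (mkℚ -[1+ a ] d c) = 0 , negative⁻¹ _

archimedean-scaled : ∀ δ → 0ℚ < δ → ∀ A → Σ ℕ (λ n → A < δ * ι n)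
archimedean-scaled δ 0<δ A = n , subst (_< δ * ι n) δ*A/δ≡A (*-monoʳ-<-pos δ {{positive 0<δ}} (proj₂ (archimedean (A * 1/δ))))
  where
  instance
    δ≢0 : NonZero δ
    δ≢0 = pos⇒nonZero δ {{positive 0<δ}}
  1/δ = 1/ δ
  n = proj₁ (archimedean (A * 1/δ))
  swap : ∀ d a r → d * (a * r) ≡ a * (d * r)
  swap = solve-∀ ℚ-ring
  δ*A/δ≡A : δ * (A * 1/δ) ≡ A
  δ*A/δ≡A = trans (swap δ A 1/δ) (trans (cong (A *_) (*-inverseʳ δ)) (*-identityʳ A))

small-inverse : ∀ δ → 0ℚ < δ → Σ ℕ (λ L → inv (suc L) < δ)
small-inverse δ 0<δ = L , subst₂ _<_ (*-identityʳ (inv (suc L))) cancel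
    (*-monoʳ-<-pos (inv (suc L)) {{positive (0<inv L)}} 1<δ·L+1)
  where
  L = proj₁ (archimedean-scaled δ 0<δ 1ℚ)
  1<δ·L+1 : 1ℚ < δ * ι (suc L)
  1<δ·L+1 = <-≤-trans (proj₂ (archimedean-scaled δ 0<δ 1ℚ)) (scale-≤ (<⇒≤ 0<δ) (ι-mono (ℕP.n≤1+n L)))
  swap : ∀ I d s → I * (d * s) ≡ d * (s * I)
  swap = solve-∀ ℚ-ring
  cancel : inv (suc L) * (δ * ι (suc L)) ≡ δ
  cancel = trans (swap (inv (suc L)) δ (ι (suc L))) (trans (cong (δ *_) (ι*inv (suc L) (ℕ.s≤s ℕ.z≤n))) (*-identityʳ δ))

1≤2^L*½^j : ∀ {j L} → j ℕ.≤ L → 1ℚ ≤ pow (ι 2) L * pow ½ j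
1≤2^L*½^j {j} {L} j≤L = subst (1ℚ ≤_) (sym split) (subst (1ℚ ≤_) (sym (*-identityʳ _)) (1≤pow-2 (L ℕ.∸ j)))
  where
  open ≡-Reasoning
  split : pow (ι 2) L * pow ½ j ≡ pow (ι 2) (L ℕ.∸ j) * 1ℚ
  split = begin
    pow (ι 2) L * pow ½ j                              ≡⟨ cong (λ z → pow (ι 2) z * pow ½ j) (sym (ℕP.m∸n+n≡m j≤L)) ⟩
    pow (ι 2) (L ℕ.∸ j ℕ.+ j) * pow ½ j                ≡⟨ cong (_* pow ½ j) (pow-+ (ι 2) (L ℕ.∸ j) j) ⟩
    pow (ι 2) (L ℕ.∸ j) * pow (ι 2) j * pow ½ j        ≡⟨ *-assoc (pow (ι 2) (L ℕ.∸ j)) (pow (ι 2) j) (pow ½ j) ⟩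
    pow (ι 2) (L ℕ.∸ j) * (pow (ι 2) j * pow ½ j)      ≡⟨ cong (pow (ι 2) (L ℕ.∸ j) *_) (trans (pow-* (ι 2) ½ j) (pow-1 j)) ⟩
    pow (ι 2) (L ℕ.∸ j) * 1ℚ                           ∎

⅓ : ℚ
⅓ = + 1 / 3

thirds : ∀ x → x * ⅓ + x * ⅓ + x * ⅓ ≡ x
thirds x = trans (factor x ⅓) (*-identityʳ x)
  where
  factor : ∀ x t → x * t + x * t + x * t ≡ x * (t + t + t)
  factor = solve-∀ ℚ-ring

module EulerTransform {f : ℕ → ℚ} (cm : CompletelyMonotone f) (f≤1/n+1 : ∀ n → f n ≤ inv (suc n)) where

  head-tail-bound : ∀ L j → f j ≤ pow (ι 2) L * pow ½ j + inv (suc L)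
  head-tail-bound L j with j ℕP.≤? L
  ... | yes j≤L = ≤-+-nonneg (≤-trans f≤1 (1≤2^L*½^j j≤L)) (0≤inv (suc L))
    where
    f≤1 : f j ≤ 1ℚ
    f≤1 = ≤-trans (CM-antitone cm ℕ.z≤n) (≤-trans (f≤1/n+1 0) (inv≤1 1 ℕP.≤-refl))
  ... | no j≰L = subst (f j ≤_) (+-comm (inv (suc L)) _)
          (≤-+-nonneg (≤-trans (CM-antitone cm (ℕP.<⇒≤ (ℕP.≰⇒> j≰L))) (f≤1/n+1 L))
            (0≤* (pow-nonneg (0≤ι 2) L) (pow-nonneg (nonNegative⁻¹ ½) j)))

  eulerError-estimate : ∀ L n → ∣ eulerError n f ∣ ≤ pow (ι 2) L * pow ¾ n + inv (suc L)
  eulerError-estimate L n = ≤-trans (eulerError-bound n f cm)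
    (majorant-bound n (pow (ι 2) L) (inv (suc L)) f (pow-nonneg (0≤ι 2) L) (0≤inv (suc L)) (head-tail-bound L))

  -- D_N f → 0: first take L with 1/(L+1) < δ/2, then N with 2^L (3/4)^N < δ/2.
  eulerError-vanishes : ∀ δ → 0ℚ < δ → Σ ℕ (λ N → ∀ n → N ℕ.≤ n → ∣ eulerError n f ∣ < δ)
  eulerError-vanishes δ 0<δ = N , small
    where
    δ/2 = δ * ½
    0<δ/2 = half-pos 0<δ
    L = proj₁ (small-inverse δ/2 0<δ/2)
    K = pow (ι 2) L
    0≤K : 0ℚ ≤ K
    0≤K = pow-nonneg (0≤ι 2) L
    N = proj₁ (archimedean-scaled δ/2 0<δ/2 (K * ι 3))
    head-small : K * pow ¾ N < δ/2
    head-small = *-cancelʳ-<-nonNeg (ι N) {{nonNegative (0≤ι N)}} (begin-strict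
      K * pow ¾ N * ι N    ≡⟨ *-assoc K (pow ¾ N) (ι N) ⟩
      K * (pow ¾ N * ι N)  ≤⟨ scale-≤ 0≤K (¾^N*N≤3 N) ⟩
      K * ι 3              <⟨ proj₂ (archimedean-scaled δ/2 0<δ/2 (K * ι 3)) ⟩
      δ/2 * ι N            ∎)
      where open ≤-Reasoning
    small : ∀ n → N ℕ.≤ n → ∣ eulerError n f ∣ < δ
    small n N≤n = begin-strict
      ∣ eulerError n f ∣        ≤⟨ eulerError-estimate L n ⟩
      K * pow ¾ n + inv (suc L) ≤⟨ +-monoˡ-≤ (inv (suc L)) (scale-≤ 0≤K (pow-antitone (nonNegative⁻¹ ¾) ¾≤1 N≤n)) ⟩
      K * pow ¾ N + inv (suc L) <⟨ +-mono-< head-small (proj₂ (small-inverse δ/2 0<δ/2)) ⟩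
      δ/2 + δ/2                 ≡⟨ halves δ ⟩
      δ                         ∎
      where
      open ≤-Reasoning
      ¾≤1 : ¾ ≤ 1ℚ
      ¾≤1 = *≤* (ℤ.+≤+ (ℕ.s≤s (ℕ.s≤s (ℕ.s≤s ℕ.z≤n))))

  -- The alternating partial sums are Cauchy, by Leibniz's tail estimate.
  altSum-cauchy : ∀ δ → 0ℚ < δ → Σ ℕ (λ N → ∀ p q → N ℕ.≤ p → N ℕ.≤ q → ∣ altSum p f - altSum q f ∣ < δ)
  altSum-cauchy δ 0<δ = L , close
    where
    L = proj₁ (small-inverse δ 0<δ)
    0≤f = CM-nonneg cm
    f↓ = CM-decreasing cm
    tail : ∀ {p q} → L ℕ.≤ p → p ℕ.≤ q → ∣ altSum q f - altSum p f ∣ < δ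
    tail {p} {q} L≤p p≤q = ≤-<-trans
      (subst (λ z → ∣ altSum z f - altSum p f ∣ ≤ f p) (ℕP.m∸n+n≡m p≤q) (altSum-tail f 0≤f f↓ p (q ℕ.∸ p)))
      (≤-<-trans (≤-trans (CM-antitone cm L≤p) (f≤1/n+1 L)) (proj₂ (small-inverse δ 0<δ)))
    flip : ∀ a b → a - b ≡ - (b - a)
    flip = solve-∀ ℚ-ring
    close : ∀ p q → L ℕ.≤ p → L ℕ.≤ q → ∣ altSum p f - altSum q f ∣ < δ
    close p q L≤p L≤q with ℕP.≤-total p q
    ... | inj₁ p≤q = subst (_< δ) (trans (sym (∣-p∣≡∣p∣ _)) (cong ∣_∣ (sym (flip (altSum p f) (altSum q f))))) (tail L≤p p≤q)
    ... | inj₂ q≤p = tail L≤q q≤p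

  -- The Euler transform is Cauchy as well:  T_p - T_q = (S_p - S_q) - D_p + D_q.
  eulerSum-cauchy : ∀ ε → 0ℚ < ε → Σ ℕ (λ N → ∀ p q → N ℕ.≤ p → N ℕ.≤ q → ∣ eulerSum p f - eulerSum q f ∣ < ε)
  eulerSum-cauchy ε 0<ε = N , close
    where
    δ = ε * ⅓
    0<δ : 0ℚ < δ
    0<δ = 0<* 0<ε (positive⁻¹ ⅓)
    N₁ = proj₁ (altSum-cauchy δ 0<δ)
    N₂ = proj₁ (eulerError-vanishes δ 0<δ)
    N = N₁ ℕ.⊔ N₂
    regroup : ∀ Sp Sq Tp Tq → Tp - Tq ≡ ((Sp - Sq) - (Sp - Tp)) + (Sq - Tq)
    regroup = solve-∀ ℚ-ring
    triangle : ∀ a b c → ∣ (a - b) + c ∣ ≤ ∣ a ∣ + ∣ b ∣ + ∣ c ∣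
    triangle a b c = ≤-trans (∣p+q∣≤∣p∣+∣q∣ (a - b) c) (+-monoˡ-≤ ∣ c ∣ (∣p-q∣≤∣p∣+∣q∣ a b))
    close : ∀ p q → N ℕ.≤ p → N ℕ.≤ q → ∣ eulerSum p f - eulerSum q f ∣ < ε
    close p q N≤p N≤q = begin-strict
      ∣ eulerSum p f - eulerSum q f ∣
        ≡⟨ cong ∣_∣ (regroup (altSum p f) (altSum q f) (eulerSum p f) (eulerSum q f)) ⟩
      ∣ (altSum p f - altSum q f) - eulerError p f + eulerError q f ∣
        ≤⟨ triangle (altSum p f - altSum q f) (eulerError p f) (eulerError q f) ⟩
      ∣ altSum p f - altSum q f ∣ + ∣ eulerError p f ∣ + ∣ eulerError q f ∣
        <⟨ +-mono-< (+-mono-< (proj₂ (altSum-cauchy δ 0<δ) p q (₁≤ N≤p) (₁≤ N≤q)) (D-small p N≤p)) (D-small q N≤q) ⟩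
      δ + δ + δ
        ≡⟨ thirds ε ⟩
      ε ∎
      where
      open ≤-Reasoning
      ₁≤ : ∀ {n} → N ℕ.≤ n → N₁ ℕ.≤ n
      ₁≤ = ℕP.≤-trans (ℕP.m≤m⊔n N₁ N₂)
      D-small : ∀ n → N ℕ.≤ n → ∣ eulerError n f ∣ < δ
      D-small n N≤n = proj₂ (eulerError-vanishes δ 0<δ) n (ℕP.≤-trans (ℕP.m≤n⊔m N₁ N₂) N≤n)

-- f_{k+1} = 1/(m j + i)^{k+1} is completely monotone: a shift by p replaces i by m p + i,
-- and the closed form exhibits every Euler coefficient as a product of non-negative factors.
invPow-CM : ∀ m i k → 1 ℕ.≤ i → CompletelyMonotone (invPow m i (suc k))
invPow-CM m i k 1≤i = completelyMonotone λ r p →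
  subst (0ℚ ≤_) (diff-cong r (λ l → cong (λ z → pow (inv z) (suc k)) (sym (reindex l p))))
    (subst (0ℚ ≤_) (sym (diff-invPow m (m ℕ.* p ℕ.+ i) (1≤affine m p i 1≤i) k r))
      (0≤* (prefactor-nonneg m (m ℕ.* p ℕ.+ i) r) (B-nonneg m (m ℕ.* p ℕ.+ i) r k)))
  where
  reindex : ∀ l p → m ℕ.* (l ℕ.+ p) ℕ.+ i ≡ m ℕ.* l ℕ.+ (m ℕ.* p ℕ.+ i)
  reindex l p = trans (cong (ℕ._+ i) (ℕP.*-distribˡ-+ m l p)) (ℕP.+-assoc (m ℕ.* l) (m ℕ.* p) i)

invPow≤1/n+1 : ∀ m i k → 1 ℕ.≤ m → 1 ℕ.≤ i → ∀ n → invPow m i (suc k) n ≤ inv (suc n)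
invPow≤1/n+1 (suc m) i k _ 1≤i n = ≤-trans
  (pow-suc≤ (0≤inv w) (inv≤1 w (1≤affine (suc m) n i 1≤i)) k)
  (inv-antitone (ℕ.s≤s ℕ.z≤n) n+1≤w)
  where
  w = suc m ℕ.* n ℕ.+ i
  n+1≤w : suc n ℕ.≤ w
  n+1≤w = subst (ℕ._≤ w) (ℕP.+-comm n 1) (ℕP.+-mono-≤ (ℕP.m≤m+n n (m ℕ.* n)) 1≤i)

theorem1 : (m i k : ℕ) → 1 ℕ.≤ m → 1 ℕ.≤ i → 1 ℕ.≤ k →
    ((ε : ℚ) → 0ℚ < ε → Σ ℕ (λ N → (p q : ℕ) → N ℕ.≤ p → N ℕ.≤ q →
        ∣ sumTo p (rhsTerm m i k) - sumTo q (rhsTerm m i k) ∣ < ε))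
    × ((ε : ℚ) → 0ℚ < ε → Σ ℕ (λ N → (n : ℕ) → N ℕ.≤ n →
        ∣ sumTo n (lhsTerm m i k) - sumTo n (rhsTerm m i k) ∣ < ε))
theorem1 m i zero    _   _   ()
theorem1 m i (suc k) 1≤m 1≤i _ = rhs-cauchy , lhs≈rhs
  where
  open EulerTransform (invPow-CM m i k 1≤i) (invPow≤1/n+1 m i k 1≤m 1≤i)
  f = invPow m i (suc k)
  rhs≡euler : ∀ n → sumTo n (rhsTerm m i (suc k)) ≡ eulerSum n f
  rhs≡euler n = sumTo-cong n (rhsTerm≡euler m i k 1≤m 1≤i)
  rhs-cauchy : ∀ ε → 0ℚ < ε → Σ ℕ (λ N → ∀ p q → N ℕ.≤ p → N ℕ.≤ q →
    ∣ sumTo p (rhsTerm m i (suc k)) - sumTo q (rhsTerm m i (suc k)) ∣ < ε)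
  rhs-cauchy ε 0<ε = proj₁ (eulerSum-cauchy ε 0<ε) , λ p q N≤p N≤q →
    subst₂ (λ u v → ∣ u - v ∣ < ε) (sym (rhs≡euler p)) (sym (rhs≡euler q)) (proj₂ (eulerSum-cauchy ε 0<ε) p q N≤p N≤q)
  lhs≈rhs : ∀ ε → 0ℚ < ε → Σ ℕ (λ N → ∀ n → N ℕ.≤ n →
    ∣ sumTo n (lhsTerm m i (suc k)) - sumTo n (rhsTerm m i (suc k)) ∣ < ε)
  lhs≈rhs ε 0<ε = proj₁ (eulerError-vanishes ε 0<ε) , λ n N≤n →
    subst (λ z → ∣ altSum n f - z ∣ < ε) (sym (rhs≡euler n)) (proj₂ (eulerError-vanishes ε 0<ε) n N≤n)
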